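{- Let $m,n$ be positive integers. Then $$\gamma_{\{2\}}(G_{m,n}) = \min\{\boldsymbol{w}_n(X) : X\in T^D(m)\},$$ where $T^D(m)\subseteq T(m)$ is the set of feasible column vectors of length $m$ all of whose entries lie in $\{\alpha_2,\alpha_{11},\alpha_{02}\}$.
   Context: The grid graph $G_{m,n}$ has vertex set $V_{m,n}=\{v_{i,j}: 1\le i\le m,\ 1\le j\le n\}$, where $v_{i_1,j_1}v_{i_2,j_2}$ is an edge iff ($|i_1-i_2|=1$ and $j_1=j_2$) or ($i_1=i_2$ and $|j_1-j_2|=1$); the $j$-th column is $\{v_{1,j},\dots,v_{m,j}\}$. $N(v)$ is the set of neighbors of $v$, $N[v]=N(v)\cup\{v\}$, and $f(S)=\sum_{v\in S}f(v)$. An integer $\{2\}$-dominating function of a graph $G=(V,E)$ is $f:V\to\mathbb{Z}_{\ge0}$ with $f(N[x])\ge 2$ for all $x\in V$; $\gamma_{\{2\}}(G)$ is the minimum of $\sum_{x\in V}f(x)$ over such $f$. Labels: given $f:V_{m,n}\to\{0,1,2\}$, each vertex $v$ receives the label $\alpha_2$ if $f(v)=2$; $\alpha_{11}$ if $f(v)=1$ and $f(N(v))\ge1$; $\alpha_{10}$ if $f(v)=1$ and $f(N(v))=0$; $\alpha_{02}$ if $f(v)=0$ and $f(N(v))\ge 2$; $\alpha_{01}$ if $f(v)=0$ and $f(N(v))=1$; $\alpha_{00}$ if $f(v)=0$ and $f(N(v))=0$. Feasible vectors: a column vector $X=(X(1),\dots,X(m))^T$ with entries in $\{\alpha_2,\alpha_{11},\alpha_{10},\alpha_{02},\alpha_{01},\alpha_{00}\}$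 is feasible if no two consecutive entries $(X(k),X(k+1))$ equal any of the ordered pairs $(\alpha_2,\alpha_{10})$, $(\alpha_2,\alpha_{01})$, $(\alpha_2,\alpha_{00})$, $(\alpha_{11},\alpha_{10})$, $(\alpha_{11},\alpha_{00})$, $(\alpha_{10},\alpha_2)$, $(\alpha_{10},\alpha_{11})$, $(\alpha_{10},\alpha_{10})$, $(\alpha_{10},\alpha_{00})$, $(\alpha_{01},\alpha_2)$, $(\alpha_{00},\alpha_2)$, $(\alpha_{00},\alpha_{11})$, $(\alpha_{00},\alpha_{10})$, and no three consecutive entries equal any of $(\alpha_{11},\alpha_{01},\alpha_{11})$, $(\alpha_{11},\alpha_{01},\alpha_{10})$, $(\alpha_{10},\alpha_{01},\alpha_{11})$, $(\alpha_{10},\alpha_{01},\alpha_{10})$. $T(m)$ is the set of feasible column vectors of length $m$. ${\cal F}_n$ (for fixed $m$) is the set of functions $f:V_{m,n}\to\{0,1,2\}$ such that $f(N[v])\ge 2$ for every vertex $v$ not in the last column (column $n$). For $X\in T(m)$, ${\cal F}_n(X)$ is the set of $f\in{\cal F}_n$ for which the labels of $v_{1,n},\dots,v_{m,n}$ with respect to $f$ are $X(1),\dots,X(m)$. The weight of $f$ is $|f|=\sum_{i=1}^m\sum_{j=1}^n f(v_{i,j})$, and $\boldsymbol{w}_n(X)=\min\{|f| : f\in{\cal F}_n(X)\}$ (taken to be $\infty$ if ${\cal F}_n(X)$ is empty). -}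

module Defs where

open import Data.Nat using (ℕ; zero; suc; _+_; _≤_; _≡ᵇ_)
open import Data.Fin using (Fin; toℕ)
import Data.Fin as F
open import Data.Bool using (Bool; true; false; _∧_; _∨_; if_then_else_)
open import Data.Vec using (Vec; []; _∷_; lookup)
open import Data.Product using (Σ; _×_; _,_)
open import Data.Sum using (_⊎_)
open import Data.Unit using (⊤)
open import Data.Empty using (⊥)
open import Relation.Binary.PropositionalEquality using (_≡_; _≢_)

sumFin : (k : ℕ) → (Fin k → ℕ) → ℕ
sumFin zero    g = 0
sumFin (suc k) g = g F.zero + sumFin k (λ i → g (F.suc i))

-- A function on the vertices of G_{m,n}; vertex v_{i,j} is (i , j) with
-- row i : Fin m and column j : Fin n (0-based: v_{i+1,j+1}).
Fun : ℕ → ℕ → Set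
Fun m n = Fin m → Fin n → ℕ

diff1 : ℕ → ℕ → Bool
diff1 a b = (suc a ≡ᵇ b) ∨ (suc b ≡ᵇ a)

adj : ∀ {m n} → Fin m → Fin n → Fin m → Fin n → Bool
adj i₁ j₁ i₂ j₂ =
  (diff1 (toℕ i₁) (toℕ i₂) ∧ (toℕ j₁ ≡ᵇ toℕ j₂)) ∨
  ((toℕ i₁ ≡ᵇ toℕ i₂) ∧ diff1 (toℕ j₁) (toℕ j₂))

nbrSum : ∀ {m n} → Fun m n → Fin m → Fin n → ℕ
nbrSum {m} {n} f i j =
  sumFin m (λ i' → sumFin n (λ j' → if adj i j i' j' then f i' j' else 0))

closedSum : ∀ {m n} → Fun m n → Fin m → Fin n → ℕ
closedSum f i j = f i j + nbrSum f i j

weight : ∀ {m n} → Fun m n → ℕ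
weight {m} {n} f = sumFin m (λ i → sumFin n (λ j → f i j))

IsInt2Dom : ∀ {m n} → Fun m n → Set
IsInt2Dom {m} {n} f = ∀ (i : Fin m) (j : Fin n) → 2 ≤ closedSum f i j

IsMinOf : (ℕ → Set) → ℕ → Set
IsMinOf P k = P k × (∀ j → P j → k ≤ j)

IsGamma2 : ℕ → ℕ → ℕ → Set
IsGamma2 m n = IsMinOf (λ k → Σ (Fun m n) λ f → IsInt2Dom f × weight f ≡ k)

data Label : Set where
  α2 α11 α10 α02 α01 α00 : Label

labelOf : ℕ → ℕ → Label
labelOf (suc (suc _)) _             = α2
labelOf 1             zero          = α10
labelOf 1             (suc _)       = α11
labelOf zero          zero          = α00
labelOf zero          1             = α01
labelOf zero          (suc (suc _)) = α02

label : ∀ {m n} → Fun m n → Fin m → Fin n → Label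
label f i j = labelOf (f i j) (nbrSum f i j)

badPair : Label → Label → Bool
badPair α2  α10 = true
badPair α2  α01 = true
badPair α2  α00 = true
badPair α11 α10 = true
badPair α11 α00 = true
badPair α10 α2  = true
badPair α10 α11 = true
badPair α10 α10 = true
badPair α10 α00 = true
badPair α01 α2  = true
badPair α00 α2  = true
badPair α00 α11 = true
badPair α00 α10 = true
badPair _   _   = false

badTriple : Label → Label → Label → Bool
badTriple α11 α01 α11 = true
badTriple α11 α01 α10 = true
badTriple α10 α01 α11 = true
badTriple α10 α01 α10 = true
badTriple _   _   _   = false

Feasible : ∀ {m} → Vec Label m → Set
Feasible []                = ⊤
Feasible (x ∷ [])          = ⊤
Feasible (x ∷ y ∷ [])      = badPair x y ≡ false
Feasible (x ∷ y ∷ z ∷ xs) =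
  badPair x y ≡ false × badTriple x y z ≡ false × Feasible (y ∷ z ∷ xs)

IsDomLabel : Label → Set
IsDomLabel α2  = ⊤
IsDomLabel α11 = ⊤
IsDomLabel α02 = ⊤
IsDomLabel _   = ⊥

InTD : ∀ {m} → Vec Label m → Set
InTD {m} X = Feasible X × (∀ (i : Fin m) → IsDomLabel (lookup X i))

IsLastCol : ∀ {n} → Fin n → Set
IsLastCol {n} j = suc (toℕ j) ≡ n

InFX : ∀ {m n} → Vec Label m → Fun m n → Set
InFX {m} {n} X f =
  (∀ (i : Fin m) (j : Fin n) → f i j ≤ 2) ×
  (∀ (i : Fin m) (j : Fin n) → ¬Last j → 2 ≤ closedSum f i j) ×
  (∀ (i : Fin m) (j : Fin n) → IsLastCol j → lookup X i ≡ label f i j)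
  where
  ¬Last : Fin n → Set
  ¬Last j = suc (toℕ j) ≢ n

-- w_n(X) = k  (finite); w_n(X) = ∞ means no k satisfies this
IsWn : ∀ {m} → ℕ → Vec Label m → ℕ → Set
IsWn {m} n X = IsMinOf (λ k → Σ (Fun m n) λ f → InFX X f × weight f ≡ k)

-- min { w_n(X) : X ∈ T^D(m) } = k  (infinite values do not attain the min)
IsMinWTD : ℕ → ℕ → ℕ → Set
IsMinWTD m n = IsMinOf (λ k → Σ (Vec Label m) λ X → InTD X × IsWn n X k)

{-# OPTIONS --safe #-}
-- A function in F_n(X) with X ∈ T^D is {2}-dominating, because α2, α11 and α02
-- are exactly the labels of the vertices v with f(N[v]) ≥ 2. Conversely, capping a
-- {2}-dominating function at 2 keeps it dominating without increasing its weight,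
-- so some minimum one takes values in {0,1,2}; it lies in F_n(X) for the vector X of
-- labels of its last column, and X ∈ T^D. The minimum itself exists constructively
-- because the capped functions form a finite, exhaustively searchable set.
module Submission where

open import Defs
open import Data.Nat using (ℕ; _≤_)
open import Data.Product using (Σ; _×_)

open import Level using (0ℓ)
open import Function using (_∘_)
open import Data.Nat using (zero; suc; _+_; _<_; _⊓_; z≤n; s≤s; s≤s⁻¹; _≤?_; _≟_)
open import Data.Nat.Properties
  using (≤-refl; ≤-reflexive; ≤-trans; +-mono-≤; +-monoʳ-≤; ⊓-monoʳ-≤; ⊓-glb;
         m⊓n≤m; m⊓n≤n; n≤1+n; ≮⇒≥; suc-injective; anyUpTo?; module ≤-Reasoning)
open import Data.Nat.Induction using (<-rec)
open import Data.Fin as Fin using (Fin; toℕ; fromℕ; fromℕ<)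
open import Data.Fin.Properties using (any?; all?; toℕ<n; toℕ-fromℕ; toℕ-fromℕ<; toℕ-injective)
open import Data.Vec using (Vec; []; _∷_; lookup; tabulate)
open import Data.Vec.Properties using (lookup∘tabulate)
open import Data.Product using (∃; _,_)
open import Data.Bool using (true; false; if_then_else_)
open import Data.Unit using (tt)
open import Relation.Nullary using (Dec; yes; no)
open import Relation.Nullary.Decidable using (map′; _×-dec_)
open import Relation.Unary using (Pred; Decidable)
open import Relation.Binary.PropositionalEquality using (_≡_; refl; sym; trans; cong; subst)

sumFin-mono : ∀ k {g h : Fin k → ℕ} → (∀ i → g i ≤ h i) → sumFin k g ≤ sumFin k h
sumFin-mono zero    g≤h = z≤n
sumFin-mono (suc k) g≤h = +-mono-≤ (g≤h Fin.zero) (sumFin-mono k (g≤h ∘ Fin.suc))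

[m+n]⊓o≤m⊓o+n⊓o : ∀ m n o → (m + n) ⊓ o ≤ m ⊓ o + n ⊓ o
[m+n]⊓o≤m⊓o+n⊓o zero    n o       = ≤-refl
[m+n]⊓o≤m⊓o+n⊓o (suc m) n zero    = z≤n
[m+n]⊓o≤m⊓o+n⊓o (suc m) n (suc o) =
  s≤s (≤-trans ([m+n]⊓o≤m⊓o+n⊓o m n o) (+-monoʳ-≤ (m ⊓ o) (⊓-monoʳ-≤ n (n≤1+n o))))

sumFin-⊓ : ∀ k (g : Fin k → ℕ) c → sumFin k g ⊓ c ≤ sumFin k (λ i → g i ⊓ c)
sumFin-⊓ zero    g c = z≤n
sumFin-⊓ (suc k) g c =
  ≤-trans ([m+n]⊓o≤m⊓o+n⊓o (g Fin.zero) _ c)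
          (+-monoʳ-≤ (g Fin.zero ⊓ c) (sumFin-⊓ k (g ∘ Fin.suc) c))

module _ {m n : ℕ} where

  infix 4 _≤ᶠ_
  _≤ᶠ_ : Fun m n → Fun m n → Set
  f ≤ᶠ g = ∀ i j → f i j ≤ g i j

  nbrSum-mono : ∀ {f g : Fun m n} → f ≤ᶠ g → ∀ i j → nbrSum f i j ≤ nbrSum g i j
  nbrSum-mono f≤g i j =
    sumFin-mono m λ i′ → sumFin-mono n λ j′ → if-mono (adj i j i′ j′) (f≤g i′ j′)
    where
    if-mono : ∀ b {x y} → x ≤ y → (if b then x else 0) ≤ (if b then y else 0)
    if-mono true  x≤y = x≤y
    if-mono false _   = z≤n

  IsInt2Dom-mono : ∀ {f g : Fun m n} → f ≤ᶠ g → IsInt2Dom f → IsInt2Dom g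
  IsInt2Dom-mono f≤g dom i j = ≤-trans (dom i j) (+-mono-≤ (f≤g i j) (nbrSum-mono f≤g i j))

  weight-mono : ∀ {f g : Fun m n} → f ≤ᶠ g → weight f ≤ weight g
  weight-mono f≤g = sumFin-mono m λ i → sumFin-mono n (f≤g i)

  nbrSum-⊓ : ∀ (f : Fun m n) c i j → nbrSum f i j ⊓ c ≤ nbrSum (λ i′ j′ → f i′ j′ ⊓ c) i j
  nbrSum-⊓ f c i j =
    ≤-trans (sumFin-⊓ m _ c) (sumFin-mono m λ i′ →
      ≤-trans (sumFin-⊓ n _ c) (sumFin-mono n λ j′ →
        ≤-reflexive (if-⊓ (adj i j i′ j′) (f i′ j′))))
    where
    if-⊓ : ∀ b x → (if b then x else 0) ⊓ c ≡ (if b then x ⊓ c else 0)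
    if-⊓ true  x = refl
    if-⊓ false x = refl

  cap₂ : Fun m n → Fun m n
  cap₂ f i j = f i j ⊓ 2

  cap₂-≤ : ∀ (f : Fun m n) → cap₂ f ≤ᶠ f
  cap₂-≤ f i j = m⊓n≤m (f i j) 2

  cap₂-dominating : ∀ {f : Fun m n} → IsInt2Dom f → IsInt2Dom (cap₂ f)
  cap₂-dominating {f} dom i j = begin
    2                                ≤⟨ ⊓-glb (dom i j) ≤-refl ⟩
    closedSum f i j ⊓ 2              ≤⟨ [m+n]⊓o≤m⊓o+n⊓o (f i j) _ 2 ⟩
    f i j ⊓ 2 + nbrSum f i j ⊓ 2     ≤⟨ +-monoʳ-≤ (f i j ⊓ 2) (nbrSum-⊓ f 2 i j) ⟩
    closedSum (cap₂ f) i j           ∎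
    where open ≤-Reasoning

  IsInt2Dom? : (f : Fun m n) → Dec (IsInt2Dom f)
  IsInt2Dom? f = all? λ i → all? λ j → 2 ≤? closedSum f i j

Exhaustible : Set → Set₁
Exhaustible A = ∀ {P : Pred A 0ℓ} → Decidable P → Dec (∃ P)

Vec-exhaustible : ∀ {A} → Exhaustible A → ∀ k → Exhaustible (Vec A k)
Vec-exhaustible ex zero    P? = map′ ([] ,_) (λ { ([] , p) → p }) (P? [])
Vec-exhaustible ex (suc k) P? =
  map′ (λ { (x , xs , p) → x ∷ xs , p }) (λ { (x ∷ xs , p) → x , xs , p })
       (ex λ x → Vec-exhaustible ex k λ xs → P? (x ∷ xs))

-- The functions V_{m,n} → {0,1,2}, as tables so that they can be enumerated.
Table : ℕ → ℕ → Set
Table m n = Vec (Vec (Fin 3) n) m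

Table-exhaustible : ∀ m n → Exhaustible (Table m n)
Table-exhaustible m n = Vec-exhaustible (Vec-exhaustible any? n) m

module _ {m n : ℕ} where

  toFun : Table m n → Fun m n
  toFun t i j = toℕ (lookup (lookup t i) j)

  toFun-≤2 : ∀ t i j → toFun t i j ≤ 2
  toFun-≤2 t i j = s≤s⁻¹ (toℕ<n (lookup (lookup t i) j))

  capTable : Fun m n → Table m n
  capTable f = tabulate λ i → tabulate λ j → fromℕ< (s≤s (m⊓n≤n (f i j) 2))

  toFun-capTable : ∀ f i j → toFun (capTable f) i j ≡ cap₂ f i j
  toFun-capTable f i j =
    trans (cong toℕ (trans (cong (λ row → lookup row j) (lookup∘tabulate _ i))
                           (lookup∘tabulate _ j)))
          (toℕ-fromℕ< _)

  capTable-dominating : ∀ {f} → IsInt2Dom f → IsInt2Dom (toFun (capTable f))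
  capTable-dominating {f} dom =
    IsInt2Dom-mono (λ i j → ≤-reflexive (sym (toFun-capTable f i j))) (cap₂-dominating dom)

  weight-capTable : ∀ f → weight (toFun (capTable f)) ≤ weight f
  weight-capTable f =
    weight-mono λ i j → ≤-trans (≤-reflexive (toFun-capTable f i j)) (cap₂-≤ f i j)

minimum-exists : ∀ {P : Pred ℕ 0ℓ} → Decidable P → ∀ {b} → P b → ∃ (IsMinOf P)
minimum-exists {P} P? {b} = <-rec (λ b → P b → ∃ (IsMinOf P)) least b
  where
  least : ∀ b → (∀ {j} → j < b → P j → ∃ (IsMinOf P)) → P b → ∃ (IsMinOf P)
  least b below pb with anyUpTo? P? b
  ... | yes (j , j<b , pj) = below j<b pj
  ... | no  none           = b , pb , λ j pj → ≮⇒≥ λ j<b → none (j , j<b , pj)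

IsOptimal : ∀ {m n} → Fun m n → Set
IsOptimal {m} {n} f = IsInt2Dom f × (∀ (g : Fun m n) → IsInt2Dom g → weight f ≤ weight g)

IsOptimal⇒IsGamma2 : ∀ {m n} {f : Fun m n} → IsOptimal f → IsGamma2 m n (weight f)
IsOptimal⇒IsGamma2 {f = f} (dom , optimal) =
  (f , dom , refl) , λ { _ (g , g-dom , refl) → optimal g g-dom }

bounded-optimal-exists : ∀ m n → Σ (Fun m n) λ f → (∀ i j → f i j ≤ 2) × IsOptimal f
bounded-optimal-exists m n with minimum-exists DominatingTableOfWeight? allTwo
  where
  DominatingTableOfWeight : ℕ → Set
  DominatingTableOfWeight k = Σ (Table m n) λ t → IsInt2Dom (toFun t) × weight (toFun t) ≡ k

  DominatingTableOfWeight? : Decidable DominatingTableOfWeight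
  DominatingTableOfWeight? k =
    Table-exhaustible m n λ t → IsInt2Dom? (toFun t) ×-dec (weight (toFun t) ≟ k)

  allTwo : DominatingTableOfWeight _
  allTwo = capTable two , capTable-dominating {f = two} (λ _ _ → s≤s (s≤s z≤n)) , refl
    where
    two : Fun m n
    two _ _ = 2
... | _ , (t , dom , refl) , least =
  toFun t , toFun-≤2 t , dom ,
  λ g g-dom → ≤-trans (least _ (capTable g , capTable-dominating g-dom , refl)) (weight-capTable g)

2≤⇒IsDomLabel : ∀ a b → 2 ≤ a + b → IsDomLabel (labelOf a b)
2≤⇒IsDomLabel zero          (suc (suc b)) _ = tt
2≤⇒IsDomLabel (suc zero)    (suc b)       _ = tt
2≤⇒IsDomLabel (suc (suc a)) b             _ = tt
2≤⇒IsDomLabel zero          zero          ()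
2≤⇒IsDomLabel zero          (suc zero)    (s≤s ())
2≤⇒IsDomLabel (suc zero)    zero          (s≤s ())

IsDomLabel⇒2≤ : ∀ a b → IsDomLabel (labelOf a b) → 2 ≤ a + b
IsDomLabel⇒2≤ zero          (suc (suc b)) _ = s≤s (s≤s z≤n)
IsDomLabel⇒2≤ (suc zero)    (suc b)       _ = s≤s (s≤s z≤n)
IsDomLabel⇒2≤ (suc (suc a)) b             _ = s≤s (s≤s z≤n)
IsDomLabel⇒2≤ zero          zero          ()
IsDomLabel⇒2≤ zero          (suc zero)    ()
IsDomLabel⇒2≤ (suc zero)    zero          ()

badPair-dom : ∀ {x y} → IsDomLabel x → IsDomLabel y → badPair x y ≡ false
badPair-dom {α10} ()
badPair-dom {α01} ()
badPair-dom {α00} ()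
badPair-dom {_} {α10} _ ()
badPair-dom {_} {α01} _ ()
badPair-dom {_} {α00} _ ()
badPair-dom {α2}  {α2}  _ _ = refl
badPair-dom {α2}  {α11} _ _ = refl
badPair-dom {α2}  {α02} _ _ = refl
badPair-dom {α11} {α2}  _ _ = refl
badPair-dom {α11} {α11} _ _ = refl
badPair-dom {α11} {α02} _ _ = refl
badPair-dom {α02} {α2}  _ _ = refl
badPair-dom {α02} {α11} _ _ = refl
badPair-dom {α02} {α02} _ _ = refl

-- Every forbidden triple has α01 in the middle.
badTriple-dom : ∀ x {y} z → IsDomLabel y → badTriple x y z ≡ false
badTriple-dom _   {α10} _ ()
badTriple-dom _   {α01} _ ()
badTriple-dom _   {α00} _ ()
badTriple-dom α11 {α2}  _ _ = refl
badTriple-dom α11 {α11} _ _ = refl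
badTriple-dom α11 {α02} _ _ = refl
badTriple-dom α10 {α2}  _ _ = refl
badTriple-dom α10 {α11} _ _ = refl
badTriple-dom α10 {α02} _ _ = refl
badTriple-dom α2  _ _ = refl
badTriple-dom α02 _ _ = refl
badTriple-dom α01 _ _ = refl
badTriple-dom α00 _ _ = refl

IsDomLabel⇒Feasible : ∀ {m} (X : Vec Label m) → (∀ i → IsDomLabel (lookup X i)) → Feasible X
IsDomLabel⇒Feasible []               _   = tt
IsDomLabel⇒Feasible (x ∷ [])         _   = tt
IsDomLabel⇒Feasible (x ∷ y ∷ [])     dom = badPair-dom (dom Fin.zero) (dom (Fin.suc Fin.zero))
IsDomLabel⇒Feasible (x ∷ y ∷ z ∷ xs) dom =
  badPair-dom (dom Fin.zero) (dom (Fin.suc Fin.zero)) ,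
  badTriple-dom x z (dom (Fin.suc Fin.zero)) ,
  IsDomLabel⇒Feasible (y ∷ z ∷ xs) (dom ∘ Fin.suc)

IsLastCol⇒≡fromℕ : ∀ {n} {j : Fin (suc n)} → IsLastCol j → j ≡ fromℕ n
IsLastCol⇒≡fromℕ {n} last = toℕ-injective (trans (suc-injective last) (sym (toℕ-fromℕ n)))

module _ {m n : ℕ} where

  InFX⇒IsInt2Dom : ∀ {X : Vec Label m} {f : Fun m n} → InTD X → InFX X f → IsInt2Dom f
  InFX⇒IsInt2Dom {f = f} (_ , X-dom) (_ , dom , labels) i j with suc (toℕ j) ≟ n
  ... | no  notLast = dom i j notLast
  ... | yes last    =
    IsDomLabel⇒2≤ (f i j) (nbrSum f i j) (subst IsDomLabel (labels i j last) (X-dom i))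

  lastLabels : Fun m (suc n) → Vec Label m
  lastLabels f = tabulate λ i → label f i (fromℕ n)

  lastLabels-InTD : ∀ {f} → IsInt2Dom f → InTD (lastLabels f)
  lastLabels-InTD {f} dom = IsDomLabel⇒Feasible (lastLabels f) X-dom , X-dom
    where
    X-dom : ∀ i → IsDomLabel (lookup (lastLabels f) i)
    X-dom i = subst IsDomLabel (sym (lookup∘tabulate _ i))
                (2≤⇒IsDomLabel (f i (fromℕ n)) (nbrSum f i (fromℕ n)) (dom i (fromℕ n)))

  lastLabels-InFX : ∀ {f} → (∀ i j → f i j ≤ 2) → IsInt2Dom f → InFX (lastLabels f) f
  lastLabels-InFX {f} f≤2 dom =
    f≤2 , (λ i j _ → dom i j) ,
    λ i j last → trans (lookup∘tabulate _ i) (cong (label f i) (sym (IsLastCol⇒≡fromℕ last)))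

  IsOptimal-≤-InFX : ∀ {f g : Fun m n} {X} → IsOptimal f → InTD X → InFX X g → weight f ≤ weight g
  IsOptimal-≤-InFX (_ , optimal) X∈TD g∈FX = optimal _ (InFX⇒IsInt2Dom X∈TD g∈FX)

lemma3p5 : (m n : ℕ) → 1 ≤ m → 1 ≤ n →
    Σ ℕ (λ k → IsGamma2 m n k × IsMinWTD m n k)
lemma3p5 m (suc n) _ _ with bounded-optimal-exists m (suc n)
... | f , f≤2 , opt@(dom , _) =
  weight f , IsOptimal⇒IsGamma2 opt ,
  (lastLabels f , lastLabels-InTD dom , (f , lastLabels-InFX f≤2 dom , refl) , w-least) ,
  minWTD-least
  where
  w-least : ∀ k → Σ (Fun m (suc n)) (λ g → InFX (lastLabels f) g × weight g ≡ k) → weight f ≤ k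
  w-least _ (g , g∈FX , refl) = IsOptimal-≤-InFX opt (lastLabels-InTD dom) g∈FX

  minWTD-least : ∀ k → Σ (Vec Label m) (λ X → InTD X × IsWn (suc n) X k) → weight f ≤ k
  minWTD-least _ (X , X∈TD , (g , g∈FX , refl) , _) = IsOptimal-≤-InFX opt X∈TD g∈FX
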